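{- Let $G$ be a loopless multigraph and let $X\subseteq V(G)$ be such that $T=G[X]$ is a tree. Let $G/T$ be the multigraph obtained from $G$ by deleting all edges of $T$ and identifying all vertices of $X$ into a single vertex $v_X$ (keeping all other edges, possibly creating parallel edges). Then ${\rm ava}(G/T)\le{\rm ava}(G)$.
   Context: A pair of parallel edges counts as a cycle of length 2. A \emph{complete arboreal coloring} of a multigraph $G$ is a partition of $V(G)$ into color classes each inducing a forest such that the union of any two distinct color classes induces a subgraph containing a cycle; ${\rm ava}(G)$ is the maximum number of colors in such a coloring. -}

module Defs where

open import Data.Nat using (ℕ; _≤_)
open import Data.Fin using (Fin; zero; suc; fromℕ; inject₁)
open import Data.Bool using (Bool; true; false; _∧_)
open import Data.Maybe using (Maybe; just; nothing)
open import Data.Product using (Σ; _×_; _,_; proj₁; proj₂; ∃)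
open import Data.Sum using (_⊎_)
open import Data.Empty using (⊥)
open import Relation.Nullary using (¬_)
open import Relation.Binary.PropositionalEquality using (_≡_; _≢_; refl)
open import Function.Definitions using (Injective)
open import Function.Bundles using (_↔_)

record Multigraph : Set₁ where
  field
    V        : Set
    E        : Set
    ends     : E → V × V
    loopless : ∀ e → proj₁ (ends e) ≢ proj₂ (ends e)
open Multigraph public

Finite : Multigraph → Set
Finite G = (Σ ℕ λ n → V G ↔ Fin n) × (Σ ℕ λ m → E G ↔ Fin m)

Joins : (G : Multigraph) → E G → V G → V G → Set
Joins G e a b = ends G e ≡ (a , b) ⊎ ends G e ≡ (b , a)

-- A cycle of G all of whose vertices lie in S (i.e. a cycle of the induced
-- subgraph G[S]): vertices v_0..v_k (k ≥ 1, so length k+1 ≥ 2), pairwise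
-- distinct, and pairwise distinct edges e_0..e_k with e_i joining v_i, v_{i+1}
-- for i < k and e_k joining v_k, v_0.  For length 2 this is a pair of parallel edges.
record CycleIn (G : Multigraph) (S : V G → Set) : Set where
  field
    k      : ℕ
    k≥1    : 1 ≤ k
    vs     : Fin (Data.Nat.suc k) → V G
    es     : Fin (Data.Nat.suc k) → E G
    vs-inj : Injective _≡_ _≡_ vs
    es-inj : Injective _≡_ _≡_ es
    step   : ∀ (i : Fin k) → Joins G (es (inject₁ i)) (vs (inject₁ i)) (vs (suc i))
    close  : Joins G (es (fromℕ k)) (vs (fromℕ k)) (vs zero)
    inS    : ∀ i → S (vs i)

record WalkIn (G : Multigraph) (S : V G → Set) (x y : V G) : Set where
  field
    k     : ℕ
    vs    : Fin (Data.Nat.suc k) → V G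
    start : vs zero ≡ x
    end   : vs (fromℕ k) ≡ y
    step  : ∀ (i : Fin k) → ∃ λ e → Joins G e (vs (inject₁ i)) (vs (suc i))
    inS   : ∀ i → S (vs i)

_∈_ : {A : Set} → A → (A → Bool) → Set
v ∈ X = X v ≡ true

IsTree : (G : Multigraph) → (V G → Bool) → Set
IsTree G X =
  (∃ λ v → v ∈ X) ×
  (∀ x y → x ∈ X → y ∈ X → WalkIn G (λ v → v ∈ X) x y) ×
  ¬ CycleIn G (λ v → v ∈ X)

-- Contraction G/T where T = G[X]: vertices are the vertices outside X plus
-- one new vertex v_X (= nothing); edges are the edges of G not in G[X]
-- (i.e. not having both ends in X); endpoints in X are redirected to v_X.
module _ (G : Multigraph) (X : V G → Bool) where
  CV : Set
  CV = Maybe (Σ (V G) λ v → X v ≡ false)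

  proj′ : (v : V G) (b : Bool) → X v ≡ b → CV
  proj′ v true  _  = nothing
  proj′ v false eq = just (v , eq)

  proj : V G → CV
  proj v = proj′ v (X v) refl

  CE : Set
  CE = Σ (E G) λ e → (X (proj₁ (ends G e)) ∧ X (proj₂ (ends G e))) ≡ false

  cends : CE → CV × CV
  cends (e , _) = proj (proj₁ (ends G e)) , proj (proj₂ (ends G e))

  private
    lemma′ : ∀ a b → a ≢ b → (p q : Bool) (ea : X a ≡ p) (eb : X b ≡ q) →
             (p ∧ q) ≡ false → proj′ a p ea ≢ proj′ b q eb
    lemma′ a b a≢b true  true  ea eb ()
    lemma′ a b a≢b true  false ea eb h ()
    lemma′ a b a≢b false true  ea eb h ()
    lemma′ a b a≢b false false ea eb h refl = a≢b refl

    lemma : ∀ a b → a ≢ b → (X a ∧ X b) ≡ false → proj a ≢ proj b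
    lemma a b a≢b h = lemma′ a b a≢b (X a) (X b) refl refl h

  cloopless : ∀ e → proj₁ (cends e) ≢ proj₂ (cends e)
  cloopless (e , h) = lemma _ _ (loopless G e) h

contract : (G : Multigraph) → (V G → Bool) → Multigraph
contract G X = record
  { V = CV G X ; E = CE G X ; ends = cends G X ; loopless = cloopless G X }

-- A complete arboreal coloring with k colors: a surjective map onto Fin k
-- (so the color classes form a partition into k nonempty classes) such that
-- each class induces a forest and any two distinct classes together induce
-- a subgraph containing a cycle.
record CompleteArboreal (G : Multigraph) (k : ℕ) (c : V G → Fin k) : Set where
  field
    onto     : ∀ i → ∃ λ v → c v ≡ i
    forest   : ∀ i → ¬ CycleIn G (λ v → c v ≡ i)
    complete : ∀ i j → i ≢ j → CycleIn G (λ v → c v ≡ i ⊎ c v ≡ j)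

HasCAC : (G : Multigraph) → ℕ → Set
HasCAC G k = Σ (V G → Fin k) (CompleteArboreal G k)

module Submission where

open import Defs
open import Data.Nat using (ℕ; _≤_)
open import Data.Bool using (Bool)
open import Data.Product using (Σ; _×_)

open import Data.Nat using (zero; suc; s≤s; z≤n)
open import Data.Nat.Properties using (≤-refl)
open import Data.Fin using (Fin; zero; suc; fromℕ; inject₁)
open import Data.Fin.Properties using (inj⇒≟; inject₁-injective; fromℕ≢inject₁)
open import Data.Bool using (true; false; _∧_)
open import Data.Bool.Properties using (¬-not) renaming (_≟_ to _≟ᵇ_)
open import Data.Maybe using (just; nothing)
open import Data.Maybe.Properties using (just-injective) renaming (≡-dec to Maybe-≡-dec)
open import Data.Product using (_,_; proj₁; proj₂; ∃; ∃₂; swap) renaming (map to map×)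
open import Data.Product.Properties using () renaming (≡-dec to Σ-≡-dec)
open import Data.Sum using (_⊎_; inj₁; inj₂)
open import Data.Empty using (⊥-elim)
open import Data.Unit using (⊤; tt)
open import Data.List using (List; []; _∷_; tabulate) renaming (_++_ to _++ˡ_)
open import Data.List.Relation.Unary.All as All using (All; []; _∷_)
open import Data.List.Relation.Unary.All.Properties using (¬Any⇒All¬) renaming (tabulate⁺ to All-tabulate⁺)
open import Data.List.Relation.Unary.Any using (here; there; any?)
open import Data.List.Relation.Unary.AllPairs using (_∷_)
open import Data.List.Relation.Unary.Unique.Propositional using (Unique)
open import Data.List.Relation.Unary.Unique.Propositional.Properties
  using (Unique[x∷xs]⇒x∉xs) renaming (tabulate⁺ to Unique-tabulate⁺)
open import Data.List.Membership.Propositional using (find) renaming (_∈_ to _∈ˡ_)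
open import Data.List.Relation.Binary.Permutation.Propositional using (_↭_; ↭-trans; prep; ↭⇒↭ₛ)
open import Data.List.Relation.Binary.Permutation.Propositional.Properties using (shift; ++-comm)
import Data.List.Relation.Binary.Permutation.Setoid.Properties as PermutationSetoid
open import Relation.Unary using (U)
open import Relation.Nullary using (¬_; Dec; yes; no)
open import Relation.Binary.Definitions using (DecidableEquality)
open import Relation.Binary.PropositionalEquality
open import Axiom.UniquenessOfIdentityProofs using (UIP; module Decidable⇒UIP)
open import Function using (_∘_)
open import Function.Definitions using (Injective)
open import Function.Properties.Inverse using (↔⇒↣)

-- Colour G by c ∘ π, where c is a complete arboreal colouring
-- of G/T and π : V(G) → V(G/T) the contraction map; the number of colours is
-- kept.  Cycles are handled through detours: an edge e together with a walk
-- between its ends avoiding e.  In a loopless multigraph with decidable vertex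
-- equality every detour yields a cycle (shorten the walk to a path and close
-- it with e), and every edge of a cycle has a detour (rotate the cycle, read
-- as a closed trail, to start with that edge).
--   * A bichromatic cycle of G/T gives a detour, which lifts to G by bridging
--     every visit of v_X with a walk inside the tree T.
--   * A monochromatic cycle of G either lies inside T, contradicting its
--     acyclicity, or uses an edge outside T, whose detour contracts to a
--     detour, hence a monochromatic cycle, of G/T.

-- Edges of G/T remember their G-edge together with a Boolean proof, so
-- equality of such edges needs uniqueness of Boolean equality proofs.
bool-uip : UIP Bool
bool-uip = Decidable⇒UIP.≡-irrelevant _≟ᵇ_

unique-rotate : ∀ {A : Set} (xs : List A) {f : A} ys →
                Unique (xs ++ˡ f ∷ ys) → Unique (f ∷ ys ++ˡ xs)
unique-rotate xs {f} ys =
  PermutationSetoid.Unique-resp-↭ (setoid _) (↭⇒↭ₛ rotation)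
  where
  rotation : xs ++ˡ f ∷ ys ↭ f ∷ ys ++ˡ xs
  rotation = ↭-trans (shift f xs ys) (prep f (++-comm xs ys))

∧-true : ∀ a {b} → a ∧ b ≡ true → a ≡ true × b ≡ true
∧-true true refl = refl , refl

true-∧ : ∀ {a b} → a ≡ true → b ≡ true → a ∧ b ≡ true
true-∧ refl refl = refl

module Walks (G : Multigraph) where

  private
    variable
      S S′   : V G → Set
      P Q    : E G → Set
      x y z x′ y′ : V G
      e f    : E G

  joins-end : Joins G f x y → Joins G f x′ y′ → x ≡ x′ ⊎ x ≡ y′
  joins-end (inj₁ e₁) (inj₁ e₂) = inj₁ (cong proj₁ (trans (sym e₁) e₂))
  joins-end (inj₁ e₁) (inj₂ e₂) = inj₂ (cong proj₁ (trans (sym e₁) e₂))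
  joins-end (inj₂ e₁) (inj₁ e₂) = inj₂ (cong proj₂ (trans (sym e₁) e₂))
  joins-end (inj₂ e₁) (inj₂ e₂) = inj₁ (cong proj₂ (trans (sym e₁) e₂))

  joins-distinct : Joins G f x y → x ≢ y
  joins-distinct {f} (inj₁ ends≡) x≡y =
    loopless G f (trans (cong proj₁ ends≡) (trans x≡y (sym (cong proj₂ ends≡))))
  joins-distinct {f} (inj₂ ends≡) x≡y =
    loopless G f (trans (cong proj₁ ends≡) (trans (sym x≡y) (sym (cong proj₂ ends≡))))

  data Walk (S : V G → Set) (P : E G → Set) : V G → V G → Set where
    nil  : S x → Walk S P x x
    cons : ∀ e → P e → Joins G e x y → S x → Walk S P y z → Walk S P x z

  edges : Walk S P x y → List (E G)
  edges (nil _)          = []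
  edges (cons e _ _ _ w) = e ∷ edges w

  _++_ : Walk S P x y → Walk S P y z → Walk S P x z
  nil _          ++ w′ = w′
  cons e p j s w ++ w′ = cons e p j s (w ++ w′)

  edges-++ : (w : Walk S P x y) (w′ : Walk S P y z) →
             edges (w ++ w′) ≡ edges w ++ˡ edges w′
  edges-++ (nil _)          w′ = refl
  edges-++ (cons e _ _ _ w) w′ = cong (e ∷_) (edges-++ w w′)

  end-in : Walk S P x y → S y
  end-in (nil s)          = s
  end-in (cons _ _ _ _ w) = end-in w

  weaken : (∀ {v} → S v → S′ v) → (∀ {f} → P f → Q f) → Walk S P x y → Walk S′ Q x y
  weaken σ ρ (nil s)          = nil (σ s)
  weaken σ ρ (cons e p j s w) = cons e (ρ p) j (σ s) (weaken σ ρ w)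

  relax : (w : Walk S P x y) → All Q (edges w) → Walk S Q x y
  relax (nil s)          []       = nil s
  relax (cons e _ j s w) (q ∷ qs) = cons e q j s (relax w qs)

  edges-relax : (w : Walk S P x y) (qs : All Q (edges w)) → edges (relax w qs) ≡ edges w
  edges-relax (nil _)          []       = refl
  edges-relax (cons e _ _ _ w) (_ ∷ qs) = cong (e ∷_) (edges-relax w qs)

  along : ∀ m (vs : Fin (suc m) → V G) →
          (∀ (i : Fin m) → Σ (E G) λ e → P e × Joins G e (vs (inject₁ i)) (vs (suc i))) →
          (∀ i → S (vs i)) → Walk S P (vs zero) (vs (fromℕ m))
  along zero    vs steps ins = nil (ins zero)
  along (suc m) vs steps ins =
    cons (proj₁ (steps zero)) (proj₁ (proj₂ (steps zero))) (proj₂ (proj₂ (steps zero)))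
         (ins zero) (along m (vs ∘ suc) (steps ∘ suc) (ins ∘ suc))

  edges-along : ∀ m (vs : Fin (suc m) → V G)
                (steps : ∀ (i : Fin m) → Σ (E G) λ e → P e × Joins G e (vs (inject₁ i)) (vs (suc i)))
                (ins : ∀ i → S (vs i)) →
                edges (along {P = P} {S = S} m vs steps ins) ≡ tabulate (proj₁ ∘ steps)
  edges-along         zero    vs steps ins = refl
  edges-along {S = S} (suc m) vs steps ins =
    cong (proj₁ (steps zero) ∷_) (edges-along {S = S} m (vs ∘ suc) (steps ∘ suc) (ins ∘ suc))

  record Detour (S : V G → Set) (e : E G) : Set where
    constructor detour
    field
      {u v} : V G
      joins : Joins G e u v
      walk  : Walk S (e ≢_) v u

  record ClosedTrail (S : V G → Set) (e : E G) : Set where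
    field
      {u v}    : V G
      joins    : Joins G e u v
      start    : S u
      rest     : Walk S U v u
      distinct : Unique (e ∷ edges rest)

    trail : Walk S U u u
    trail = cons e tt joins start rest

  firstDetour : ClosedTrail S e → Detour S e
  firstDetour C = detour joins (relax rest (¬Any⇒All¬ _ (Unique[x∷xs]⇒x∉xs distinct)))
    where open ClosedTrail C

  firstDetour-edges : (C : ClosedTrail S e) →
                      edges (Detour.walk (firstDetour C)) ≡ edges (ClosedTrail.rest C)
  firstDetour-edges C = edges-relax (ClosedTrail.rest C) _

  record Split (w : Walk S P x y) (f : E G) : Set where
    field
      {a b}       : V G
      before      : Walk S P x a
      joins       : Joins G f a b
      after       : Walk S P b y
      edges-split : edges w ≡ edges before ++ˡ f ∷ edges after

  split : (w : Walk S P x y) → f ∈ˡ edges w → Split w f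
  split (cons e p j s w) (here refl) = record
    { before = nil s ; joins = j ; after = w ; edges-split = refl }
  split (cons e p j s w) (there f∈) = record
    { before = cons e p j s before ; joins = joins ; after = after
    ; edges-split = cong (e ∷_) edges-split }
    where open Split (split w f∈)

  rotate : (C : ClosedTrail S e) → f ∈ˡ edges (ClosedTrail.trail C) → ClosedTrail S f
  rotate {f = f} C f∈ = record
    { joins    = joins
    ; start    = end-in before
    ; rest     = after ++ before
    ; distinct = subst (λ es → Unique (f ∷ es)) (sym (edges-++ after before))
                   (unique-rotate (edges before) (edges after)
                     (subst Unique edges-split (ClosedTrail.distinct C)))
    }
    where open Split (split (ClosedTrail.trail C) f∈)

  trailOfCycle : CycleIn G S → Σ (E G) (ClosedTrail S)
  trailOfCycle {S} C = es (fromℕ k) , record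
    { joins    = close
    ; start    = inS (fromℕ k)
    ; rest     = path
    ; distinct = subst (λ es′ → Unique (es (fromℕ k) ∷ es′)) (sym (edges-along {S = S} k vs steps inS))
                   (All-tabulate⁺ (λ i → fromℕ≢inject₁ ∘ es-inj)
                    ∷ Unique-tabulate⁺ (inject₁-injective ∘ es-inj))
    }
    where
    open CycleIn C
    steps : ∀ (i : Fin k) → Σ (E G) λ e → U e × Joins G e (vs (inject₁ i)) (vs (suc i))
    steps i = es (inject₁ i) , tt , step i
    path : Walk S U (vs zero) (vs (fromℕ k))
    path = along k vs steps inS

  len : Walk S P x y → ℕ
  len (nil _)          = zero
  len (cons _ _ _ _ w) = suc (len w)

  vertex : (w : Walk S P x y) → Fin (suc (len w)) → V G
  vertex (nil {x} _)          zero    = x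
  vertex (cons {x} _ _ _ _ _) zero    = x
  vertex (cons _ _ _ _ w)     (suc i) = vertex w i

  vertex-start : (w : Walk S P x y) → vertex w zero ≡ x
  vertex-start (nil _)          = refl
  vertex-start (cons _ _ _ _ _) = refl

  vertex-end : (w : Walk S P x y) → vertex w (fromℕ (len w)) ≡ y
  vertex-end (nil _)          = refl
  vertex-end (cons _ _ _ _ w) = vertex-end w

  vertex-in : (w : Walk S P x y) → ∀ i → S (vertex w i)
  vertex-in (nil s)          zero    = s
  vertex-in (cons _ _ _ s _) zero    = s
  vertex-in (cons _ _ _ _ w) (suc i) = vertex-in w i

  Simple : Walk S P x y → Set
  Simple (nil _)              = ⊤
  Simple (cons {x} _ _ _ _ w) = (∀ i → x ≢ vertex w i) × Simple w

  vertex-injective : (w : Walk S P x y) → Simple w → Injective _≡_ _≡_ (vertex w)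
  vertex-injective (nil _)          _            {zero}  {zero}  _  = refl
  vertex-injective (cons _ _ _ _ _) _            {zero}  {zero}  _  = refl
  vertex-injective (cons _ _ _ _ w) (fresh , _)  {zero}  {suc j} eq = ⊥-elim (fresh j eq)
  vertex-injective (cons _ _ _ _ w) (fresh , _)  {suc i} {zero}  eq = ⊥-elim (fresh i (sym eq))
  vertex-injective (cons _ _ _ _ w) (_ , simple) {suc i} {suc j} eq =
    cong suc (vertex-injective w simple eq)

  module _ (_≟_ : DecidableEquality (V G)) where

    suffixFrom : ∀ x (w : Walk S P y z) → Simple w →
                 Σ (Walk S P x z) Simple ⊎ (∀ i → x ≢ vertex w i)
    suffixFrom x (nil {y} s) _ with x ≟ y
    ... | yes refl = inj₁ (nil s , tt)
    ... | no x≢y   = inj₂ λ { zero → x≢y }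
    suffixFrom x (cons {y} e p j s w) (fresh , simple) with x ≟ y
    ... | yes refl = inj₁ (cons e p j s w , fresh , simple)
    ... | no x≢y with suffixFrom x w simple
    ...   | inj₁ found = inj₁ found
    ...   | inj₂ x∉w   = inj₂ λ { zero → x≢y ; (suc i) → x∉w i }

    shorten : Walk S P x y → Σ (Walk S P x y) Simple
    shorten (nil s) = nil s , tt
    shorten (cons {x} e p j s w) with shorten w
    ... | w′ , simple with suffixFrom x w′ simple
    ...   | inj₁ found = found
    ...   | inj₂ fresh = cons e p j s w′ , fresh , simple

  closing : (w : Walk S P x y) → E G → Fin (suc (len w)) → E G
  closing (nil _)          e zero    = e
  closing (cons f _ _ _ _) e zero    = f
  closing (cons _ _ _ _ w) e (suc i) = closing w e i

  closing-step : (w : Walk S P x y) → ∀ (i : Fin (len w)) →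
                 Joins G (closing w e (inject₁ i)) (vertex w (inject₁ i)) (vertex w (suc i))
  closing-step (cons f _ j _ w) zero    = subst (Joins G f _) (sym (vertex-start w)) j
  closing-step (cons _ _ _ _ w) (suc i) = closing-step w i

  closing-last : (w : Walk S P x y) → closing w e (fromℕ (len w)) ≡ e
  closing-last (nil _)          = refl
  closing-last (cons _ _ _ _ w) = closing-last w

  -- An edge f ≠ e leaving a vertex x off the walk w is none of the edges
  -- of w followed by e: each of those is e or has both ends on w.
  closing-off : (w : Walk S P y z) → (∀ t → x ≢ vertex w t) → e ≢ f → Joins G f x x′ →
                ∀ i → closing w e i ≢ f
  closing-off (nil _)           _     e≢f _  zero    refl = e≢f refl
  closing-off (cons _ _ j _ w)  fresh _   j′ zero    refl with joins-end j′ j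
  ... | inj₁ x≡start = fresh zero x≡start
  ... | inj₂ x≡next  = fresh (suc zero) (trans x≡next (sym (vertex-start w)))
  closing-off (cons _ _ _ _ w)  fresh e≢f j′ (suc i) = closing-off w (fresh ∘ suc) e≢f j′ i

  closing-injective : (w : Walk S (e ≢_) x y) → Simple w → Injective _≡_ _≡_ (closing w e)
  closing-injective (nil _)            _            {zero}  {zero}  _  = refl
  closing-injective (cons _ _ _ _ _)   _            {zero}  {zero}  _  = refl
  closing-injective (cons _ e≢f j _ w) (fresh , _)  {zero}  {suc i} eq =
    ⊥-elim (closing-off w fresh e≢f j i (sym eq))
  closing-injective (cons _ e≢f j _ w) (fresh , _)  {suc i} {zero}  eq =
    ⊥-elim (closing-off w fresh e≢f j i eq)
  closing-injective (cons _ _ _ _ w)   (_ , simple) {suc i} {suc j} eq =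
    cong suc (closing-injective w simple eq)

  joins-cong : f ≡ e → x ≡ x′ → y ≡ y′ → Joins G f x y → Joins G e x′ y′
  joins-cong refl refl refl j = j

  pathCycle : Joins G e x y → (w : Walk S (e ≢_) y x) → Simple w → CycleIn G S
  pathCycle j (nil _) _ = ⊥-elim (joins-distinct j refl)
  pathCycle {e = e} j w@(cons _ _ _ _ _) simple = record
    { k      = len w
    ; k≥1    = s≤s z≤n
    ; vs     = vertex w
    ; es     = closing w e
    ; vs-inj = vertex-injective w simple
    ; es-inj = closing-injective w simple
    ; step   = closing-step w
    ; close  = joins-cong (sym (closing-last w)) (sym (vertex-end w)) (sym (vertex-start w)) j
    ; inS    = vertex-in w
    }

  detourCycle : DecidableEquality (V G) → Detour S e → CycleIn G S
  detourCycle _≟_ (detour j w) with shorten _≟_ w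
  ... | path , simple = pathCycle j path simple

module Contraction (G : Multigraph) (X : V G → Bool) where

  G/T : Multigraph
  G/T = contract G X

  open Walks G
  module W/T = Walks G/T

  π : V G → V G/T
  π = proj G X

  private
    variable
      S    : V G/T → Set
      R    : V G → Set
      P    : E G → Set
      x y a b : V G
      c d  : V G/T
      e    : E G

  Inside : E G → Set
  Inside e = (X (proj₁ (ends G e)) ∧ X (proj₂ (ends G e))) ≡ true

  Outside : E G → Set
  Outside e = (X (proj₁ (ends G e)) ∧ X (proj₂ (ends G e))) ≡ false

  inside-ends : Inside e → Joins G e a b → a ∈ X × b ∈ X
  inside-ends ins (inj₁ refl) = ∧-true (X _) ins
  inside-ends ins (inj₂ refl) = swap (∧-true (X _) ins)

  ends-inside : Joins G e a b → a ∈ X → b ∈ X → Inside e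
  ends-inside (inj₁ refl) a∈ b∈ = true-∧ a∈ b∈
  ends-inside (inj₂ refl) a∈ b∈ = true-∧ b∈ a∈

  π-inside : x ∈ X → π x ≡ nothing
  π-inside {x} x∈ = go (X x) refl
    where
    go : ∀ bx (eq : X x ≡ bx) → proj′ G X x bx eq ≡ nothing
    go true  _  = refl
    go false eq with trans (sym x∈) eq
    ... | ()

  π-outside : (x∉ : X x ≡ false) → π x ≡ just (x , x∉)
  π-outside {x} x∉ = go (X x) refl
    where
    go : ∀ bx (eq : X x ≡ bx) → proj′ G X x bx eq ≡ just (x , x∉)
    go false eq = cong (λ p → just (x , p)) (bool-uip eq x∉)
    go true  eq with trans (sym x∉) eq
    ... | ()

  π-nothing : π x ≡ nothing → x ∈ X
  π-nothing {x} = go (X x) refl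
    where
    go : ∀ bx (eq : X x ≡ bx) → proj′ G X x bx eq ≡ nothing → x ∈ X
    go true  eq _ = eq

  π-injective-outside : X x ≡ false → π x ≡ π y → x ≡ y
  π-injective-outside {x} {y} x∉ πx≡πy = go (X y) refl (trans (sym (π-outside x∉)) πx≡πy)
    where
    go : ∀ by (eq : X y ≡ by) → just (x , x∉) ≡ proj′ G X y by eq → x ≡ y
    go false eq same = cong proj₁ (just-injective same)

  joins↑ : (out : Outside e) → Joins G e a b → Joins G/T (e , out) (π a) (π b)
  joins↑ _ (inj₁ eq) = inj₁ (cong (map× π π) eq)
  joins↑ _ (inj₂ eq) = inj₂ (cong (map× π π) eq)

  joins↓ : (ê : E G/T) → Joins G/T ê c d →
           ∃₂ λ a b → π a ≡ c × π b ≡ d × Joins G (proj₁ ê) a b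
  joins↓ _ (inj₁ eq) = _ , _ , cong proj₁ eq , cong proj₂ eq , inj₁ refl
  joins↓ _ (inj₂ eq) = _ , _ , cong proj₂ eq , cong proj₁ eq , inj₂ refl

  lower-≢ : {ê ê′ : E G/T} → ê ≢ ê′ → proj₁ ê ≢ proj₁ ê′
  lower-≢ ne refl = ne (cong (_ ,_) (bool-uip _ _))

  contractWalk : {out : Outside e} →
                 Walk (S ∘ π) (e ≢_) x y → W/T.Walk S ((e , out) ≢_) (π x) (π y)
  contractWalk (nil s) = W/T.nil s
  contractWalk {S = S} (cons {x} {x′} {y} f e≢f j s w)
    with X (proj₁ (ends G f)) ∧ X (proj₂ (ends G f)) in status
  ... | true  = subst (λ c → W/T.Walk S _ c (π y)) (same-image (inside-ends status j))
                  (contractWalk w)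
    where
    same-image : x ∈ X × x′ ∈ X → π x′ ≡ π x
    same-image (x∈ , x′∈) = trans (π-inside x′∈) (sym (π-inside x∈))
  ... | false = W/T.cons (f , status) (e≢f ∘ cong proj₁) (joins↑ status j) s (contractWalk w)

  inside-not-outside : Inside e → ¬ Outside e
  inside-not-outside ins out with trans (sym ins) out
  ... | ()

  outside? : ∀ e → Dec (Outside e)
  outside? e = X (proj₁ (ends G e)) ∧ X (proj₂ (ends G e)) ≟ᵇ false

  treeWalk : IsTree G X → a ∈ X → b ∈ X → Walk (_∈ X) Inside a b
  treeWalk (_ , connected , _) a∈ b∈ =
    subst₂ (Walk (_∈ X) Inside) start end (along k vs steps inS)
    where
    open WalkIn (connected _ _ a∈ b∈)
    steps : ∀ i → Σ (E G) λ f → Inside f × Joins G f (vs (inject₁ i)) (vs (suc i))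
    steps i = proj₁ (step i) , ends-inside (proj₂ (step i)) (inS _) (inS _) , proj₂ (step i)

  -- Vertices with the same image in G/T are joined in G by a walk through
  -- vertices of that image avoiding any surviving edge: they are equal, or
  -- both lie in the tree T.
  reconnect : IsTree G X → Outside e → π a ≡ π b → S (π a) → Walk (S ∘ π) (e ≢_) a b
  reconnect {e} {a} {b} {S} tree out πa≡πb s with X a ≟ᵇ false
  ... | yes a∉ = subst (Walk (S ∘ π) (e ≢_) a) (π-injective-outside a∉ πa≡πb) (nil s)
  ... | no  ¬a∉ = weaken (λ v∈ → subst S (trans (π-inside a∈) (sym (π-inside v∈))) s)
                        (λ { ins refl → inside-not-outside ins out })
                        (treeWalk tree a∈ b∈)
    where
    a∈ : a ∈ X
    a∈ = ¬-not ¬a∉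
    b∈ : b ∈ X
    b∈ = π-nothing (trans (sym πa≡πb) (π-inside a∈))

  -- Lifting a walk of G/T to G, between any preimages of its ends: each
  -- edge lifts to itself, and each visit of v_X is bridged inside T.
  liftWalk : IsTree G X → {out : Outside e} →
             W/T.Walk S ((e , out) ≢_) c d → π a ≡ c → π b ≡ d → Walk (S ∘ π) (e ≢_) a b
  liftWalk {S = S} tree {out} (W/T.nil s) πa πb =
    reconnect {S = S} tree out (trans πa (sym πb)) (subst S (sym πa) s)
  liftWalk {S = S} tree {out} (W/T.cons ê ê≢ j s w) πa πb with joins↓ ê j
  ... | a′ , b′ , πa′ , πb′ , j′ =
    reconnect {S = S} tree out (trans πa (sym πa′)) (subst S (sym πa) s)
    ++ cons (proj₁ ê) (lower-≢ ê≢) j′ (subst S (sym πa′) s) (liftWalk {S = S} tree w πb′ πb)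

  restrictX : (w : Walk R P x y) → All Inside (edges w) → y ∈ X → Walk (_∈ X) P x y
  restrictX (nil _)          []           y∈ = nil y∈
  restrictX (cons f p j _ w) (ins ∷ inss) y∈ =
    cons f p j (proj₁ (inside-ends ins j)) (restrictX w inss y∈)

  detour↓ : (out : Outside e) → Detour (S ∘ π) e → W/T.Detour S (e , out)
  detour↓ out (detour j w) = W/T.detour (joins↑ out j) (contractWalk w)

  detour↑ : IsTree G X → {out : Outside e} → W/T.Detour S (e , out) → Detour (S ∘ π) e
  detour↑ {e = e} {S = S} tree {out} (W/T.detour j w) with joins↓ (e , out) j
  ... | a , b , πa , πb , j′ = detour j′ (liftWalk {S = S} tree w πb πa)

  detourInX : (d : Detour R e) → All Inside (e ∷ edges (Detour.walk d)) → Detour (_∈ X) e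
  detourInX (detour j w) (ins ∷ inss) = detour j (restrictX w inss (proj₁ (inside-ends ins j)))

  trailDichotomy : ClosedTrail (S ∘ π) e → (∃ λ ê → W/T.Detour S ê) ⊎ Detour (_∈ X) e
  trailDichotomy C with any? outside? (edges (ClosedTrail.trail C))
  ... | yes some = let f , f∈ , out = find some in
                   inj₁ ((f , out) , detour↓ out (firstDetour (rotate C f∈)))
  ... | no none = inj₂ (detourInX (firstDetour C)
                    (subst (λ es → All Inside (_ ∷ es)) (sym (firstDetour-edges C))
                      (All.map ¬-not (¬Any⇒All¬ _ none))))

  decEq/T : DecidableEquality (V G) → DecidableEquality (V G/T)
  decEq/T _≟_ = Maybe-≡-dec (Σ-≡-dec _≟_ (λ p q → yes (bool-uip p q)))

lemma2p15 : (G : Multigraph) → Finite G → (X : V G → Bool) → IsTree G X →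
    ∀ k → HasCAC (contract G X) k → Σ ℕ λ k′ → k ≤ k′ × HasCAC G k′
lemma2p15 G ((_ , V≅Fin) , _) X tree k (c , cac) =
  k , ≤-refl , c ∘ π , record { onto = onto ; forest = forest ; complete = complete }
  where
  open Contraction G X
  open Walks G
  module CAC = CompleteArboreal cac

  _≟_ : DecidableEquality (V G)
  _≟_ = inj⇒≟ (↔⇒↣ V≅Fin)

  -- v_X has the root of T as preimage, every other vertex of G/T itself.
  onto : ∀ i → ∃ λ v → c (π v) ≡ i
  onto i with CAC.onto i
  ... | nothing      , ci = proj₁ (proj₁ tree) , trans (cong c (π-inside (proj₂ (proj₁ tree)))) ci
  ... | just (v , p) , ci = v , trans (cong c (π-outside p)) ci

  -- A monochromatic cycle of G would give one in G/T or one inside T.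
  forest : ∀ i → ¬ CycleIn G (λ v → c (π v) ≡ i)
  forest i cycle with trailDichotomy (proj₂ (trailOfCycle cycle))
  ... | inj₁ (_ , d) = CAC.forest i (W/T.detourCycle (decEq/T _≟_) d)
  ... | inj₂ d       = proj₂ (proj₂ tree) (detourCycle _≟_ d)

  -- A cycle of G/T in two colour classes lifts to one of G.
  complete : ∀ i j → i ≢ j → CycleIn G (λ v → c (π v) ≡ i ⊎ c (π v) ≡ j)
  complete i j i≢j with W/T.trailOfCycle (CAC.complete i j i≢j)
  ... | _ , C = detourCycle _≟_ (detour↑ tree (W/T.firstDetour C))
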